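{- If $G$ is a connected graph with at least two vertices and domination number $\gamma(G)\leq 2$, then $\operatorname{th}_d(G)=\operatorname{th}_c(G)-1$.
   Context: $\gamma(G)$ is the minimum size of a set $S\subseteq V(G)$ whose closed neighborhood is $V(G)$. Cops and Robbers on a finite simple graph with $n$ vertices: in round $0$ each of $k$ cops and then the robber choose a vertex; in each later round each cop stays or moves along an edge, then the robber does the same; capture occurs when a cop occupies the robber's vertex. $\operatorname{capt}_k(G)$ is the minimum number of rounds for $k$ cops to capture a robber who evades as long as possible ($\infty$ if $k$ is less than the cop number). A vertex is damaged if the robber occupies it in a round in which capture does not occur; $\operatorname{dmg}_k(G)$ is the minimum number of damaged vertices over games with $k$ cops when the robber maximizes damage. $\operatorname{th}_c(G)=\min_{1\le k\le n}\{k+\operatorname{capt}_k(G)\}$, $\operatorname{th}_d(G)=\min_{1\le k\le n}\{k+\operatorname{dmg}_k(G)\}$. -}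

module Defs where

open import Level using (0ℓ)
open import Data.Bool using (Bool; true; false)
open import Data.Nat using (ℕ; zero; suc; _+_; _≤_)
open import Data.Fin using (Fin)
open import Data.Fin.Subset using (Subset; _∈_; _∪_; ⁅_⁆; ∣_∣; ⊥)
open import Data.Product using (Σ; ∃; ∃-syntax; _×_; _,_)
open import Data.Sum using (_⊎_)
open import Data.Empty renaming (⊥ to Empty)
open import Relation.Binary.PropositionalEquality using (_≡_)
open import Relation.Binary.Construct.Closure.ReflexiveTransitive using (Star)

record Graph (n : ℕ) : Set where
  field
    adj     : Fin n → Fin n → Bool
    symm    : ∀ u v → adj u v ≡ adj v u
    irrefl  : ∀ v → adj v v ≡ false

module _ {n : ℕ} (G : Graph n) where
  open Graph G

  Adj : Fin n → Fin n → Set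
  Adj u v = adj u v ≡ true

  Connected : Set
  Connected = ∀ u v → Star Adj u v

  Dominating : Subset n → Set
  Dominating S = ∀ v → v ∈ S ⊎ ∃[ u ] (u ∈ S × Adj u v)

IsMinimum : (ℕ → Set) → ℕ → Set
IsMinimum P m = P m × (∀ x → P x → m ≤ x)

module _ {n : ℕ} (G : Graph n) where
  open Graph G

  IsDomNumber : ℕ → Set
  IsDomNumber = IsMinimum (λ g → ∃[ S ] (Dominating G S × ∣ S ∣ ≡ g))

  Step : Fin n → Fin n → Set
  Step u v = v ≡ u ⊎ Adj G u v

  -- positions of k cops (several cops may share a vertex)
  Cops : ℕ → Set
  Cops k = Fin k → Fin n

  _∈c_ : ∀ {k} → Fin n → Cops k → Set
  r ∈c c = ∃[ i ] (c i ≡ r)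

  Move : ∀ {k} → Cops k → Cops k → Set
  Move c c' = ∀ i → Step (c i) (c' i)

  -- Win t c r : the cops at c, robber at r (position at the end of a
  -- round, robber having just moved / been placed) — the cops can force
  -- capture within at most t further rounds.
  Win : ∀ {k} → ℕ → Cops k → Fin n → Set
  Win zero    c r = r ∈c c
  Win (suc t) c r = r ∈c c ⊎
    ∃[ c' ] (Move c c' × (r ∈c c' ⊎ (∀ r' → Step r r' → Win t c' r')))

  -- k cops can capture the robber by round t (round 0 = placement)
  CaptWithin : ℕ → ℕ → Set
  CaptWithin k t = ∃[ c₀ ] (∀ (r₀ : Fin n) → Win {k} t c₀ r₀)

  -- capt_k(G) = t   (capt_k(G) = ∞ corresponds to no such t)
  IsCapt : ℕ → ℕ → Set
  IsCapt k = IsMinimum (CaptWithin k)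

  -- A vertex r becomes damaged when the robber sits on r and the
  -- cops' move of a round (round ≥ 1) fails to capture him.  The cops can
  -- keep the damage ≤ d iff there is a set Inv of reachable states
  -- (cops, robber, damaged set), closed under the game, from which the
  -- cops always have a reply keeping the damage ≤ d (safety game).
  DmgAtMost : ℕ → ℕ → Set₁
  DmgAtMost k d = Σ (Cops k → Fin n → Subset n → Set) λ Inv →
      (∃[ c₀ ] (∀ r₀ → r₀ ∈c c₀ ⊎ Inv c₀ r₀ ⊥))
    × (∀ c r D → Inv c r D →
         ∃[ c' ] (Move c c' ×
           (r ∈c c' ⊎
             (∣ D ∪ ⁅ r ⁆ ∣ ≤ d ×
              (∀ r' → Step r r' → r' ∈c c' ⊎ Inv c' r' (D ∪ ⁅ r ⁆))))))

  IsDmg : ℕ → ℕ → Set₁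
  IsDmg k d = DmgAtMost k d × (∀ x → DmgAtMost k x → d ≤ x)

  IsThc : ℕ → Set
  IsThc = IsMinimum (λ m → ∃[ k ] ∃[ t ] (1 ≤ k × k ≤ n × IsCapt k t × k + t ≡ m))

  IsThd : ℕ → Set₁
  IsThd m =
      (∃[ k ] ∃[ d ] (1 ≤ k × k ≤ n × IsDmg k d × k + d ≡ m))
    × (∀ x → (∃[ k ] ∃[ d ] (1 ≤ k × k ≤ n × IsDmg k d × k + d ≡ x)) → m ≤ x)

-- A dominating set S of size γ lets γ cops capture the robber in one round
-- with no damage, so th_c ≤ γ + 1 and th_d ≤ γ.  For γ ≤ 2 the matching lower
-- bounds reduce to a few small games: capturing in round 0 means occupying
-- every vertex, and capturing in round 1 (or with no damage at all) means the
-- initial cop positions dominate G; with one cop that is a universal vertex,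
-- which γ = 2 excludes.  Hence th_c = γ + 1 and th_d = γ.
module Submission where

open import Defs
open import Data.Nat using (ℕ; zero; suc; _+_; _≤_; _∸_; z≤n; s≤s)
open import Data.Nat.Properties using (≤-antisym; ≤-trans; m≤m+n; +-cancelˡ-≤)
open import Data.Product using (Σ; ∃; ∃-syntax; ∄; _×_; _,_)
open import Data.Sum using (_⊎_; inj₁; inj₂)
open import Data.Bool using (true; false; if_then_else_)
open import Data.Fin using (Fin; zero; suc)
open import Data.Fin.Subset using (Subset; _∈_; _∪_; ⁅_⁆; ∣_∣; ⊥; inside; outside)
open import Data.Fin.Subset.Properties
  using (x∈⁅x⁆; x∈⁅y⁆⇒x≡y; ∣⁅x⁆∣≡1; x∈p∪q⁺; p⊆q⇒∣p∣≤∣q∣)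
open import Data.Vec using ([]; _∷_; here; there)
open import Data.Empty using (⊥-elim)
open import Relation.Nullary using (¬_)
open import Relation.Binary.PropositionalEquality using (_≡_; refl; sym; trans; subst; cong)
open import Relation.Binary.Construct.Closure.ReflexiveTransitive using (ε; _◅_)

isMinimum-unique : ∀ {P : ℕ → Set} {a b} → IsMinimum P a → IsMinimum P b → a ≡ b
isMinimum-unique (pa , a-min) (pb , b-min) = ≤-antisym (a-min _ pb) (b-min _ pa)

x∈p⇒1≤∣p∣ : ∀ {n} {x : Fin n} {p : Subset n} → x ∈ p → 1 ≤ ∣ p ∣
x∈p⇒1≤∣p∣ {x = x} {p} x∈p = subst (_≤ ∣ p ∣) (∣⁅x⁆∣≡1 x)
  (p⊆q⇒∣p∣≤∣q∣ λ y∈⁅x⁆ → subst (_∈ p) (sym (x∈⁅y⁆⇒x≡y _ y∈⁅x⁆)) x∈p)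

members : ∀ {n} (S : Subset n) →
          Σ (Fin ∣ S ∣ → Fin n) λ f → ∀ {v} → v ∈ S → ∃[ i ] f i ≡ v
members [] = (λ ()) , λ ()
members (inside ∷ S) with f , f-onto ← members S = g , g-onto
  where
  g : Fin (suc ∣ S ∣) → Fin _
  g zero    = zero
  g (suc i) = suc (f i)
  g-onto : ∀ {v} → v ∈ inside ∷ S → ∃[ i ] g i ≡ v
  g-onto here = zero , refl
  g-onto (there v∈S) with i , fi≡v ← f-onto v∈S = suc i , cong suc fi≡v
members (outside ∷ S) with f , f-onto ← members S = (λ i → suc (f i)) , g-onto
  where
  g-onto : ∀ {v} → v ∈ outside ∷ S → ∃[ i ] suc (f i) ≡ v
  g-onto (there v∈S) with i , fi≡v ← f-onto v∈S = i , cong suc fi≡v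

module _ {n : ℕ} (G : Graph n) where
  open Graph G

  Universal : Fin n → Set
  Universal v = ∀ u → Step G v u

  CopsDominate : ∀ {k} → Cops G k → Set
  CopsDominate c = ∀ r → ∃[ i ] Step G (c i) r

  universal⇒dominating : ∀ {v} → Universal v → Dominating G ⁅ v ⁆
  universal⇒dominating {v} univ u with univ u
  ... | inj₁ u≡v = inj₁ (subst (_∈ ⁅ v ⁆) (sym u≡v) (x∈⁅x⁆ v))
  ... | inj₂ v~u = inj₂ (v , x∈⁅x⁆ v , v~u)

  oneCopDominates⇒universal : {c : Cops G 1} → CopsDominate c → Universal (c zero)
  oneCopDominates⇒universal dom r with dom r
  ... | zero , step = step

  domNumber-positive : ∀ {g} → 1 ≤ n → IsDomNumber G g → 1 ≤ g
  domNumber-positive (s≤s _) ((S , dom , refl) , _) with dom zero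
  ... | inj₁ 0∈S           = x∈p⇒1≤∣p∣ 0∈S
  ... | inj₂ (_ , u∈S , _) = x∈p⇒1≤∣p∣ u∈S

  domNumber-2⇒∄universal : IsDomNumber G 2 → ∄ Universal
  domNumber-2⇒∄universal (_ , γ-min) (v , univ)
    with γ-min 1 (⁅ v ⁆ , universal⇒dominating univ , ∣⁅x⁆∣≡1 v)
  ... | s≤s ()

  chase : Fin n → Fin n → Fin n
  chase u r = if adj u r then r else u

  step-chase : ∀ u r → Step G u (chase u r)
  step-chase u r with adj u r in u~r
  ... | true  = inj₂ u~r
  ... | false = inj₁ refl

  chase-reaches : ∀ {u r} → Step G u r → chase u r ≡ r
  chase-reaches {u} (inj₁ refl) rewrite irrefl u = refl
  chase-reaches (inj₂ u~r) rewrite u~r = refl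

  copsDominate⇒captWithin-1 : ∀ {k} {c : Cops G k} → CopsDominate c → CaptWithin G k 1
  copsDominate⇒captWithin-1 {c = c} dom = c , λ r →
    inj₂ ((λ i → chase (c i) r) , (λ i → step-chase (c i) r) ,
          inj₁ (let i , step = dom r in i , chase-reaches step))

  copsDominate⇒dmgAtMost-0 : ∀ {k} {c : Cops G k} → CopsDominate c → DmgAtMost G k 0
  copsDominate⇒dmgAtMost-0 {c = c} dom =
    (λ c' _ _ → c' ≡ c) , (c , λ _ → inj₂ refl) , λ { _ r _ refl →
      (λ i → chase (c i) r) , (λ i → step-chase (c i) r) ,
      inj₁ (let i , step = dom r in i , chase-reaches step) }

  dominating⇒copsDominate : ∀ {S} → Dominating G S → Σ (Cops G ∣ S ∣) CopsDominate
  dominating⇒copsDominate {S} dom with f , f-onto ← members S = f , λ r → cover r (dom r)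
    where
    cover : ∀ r → r ∈ S ⊎ ∃[ u ] (u ∈ S × Adj G u r) → ∃[ i ] Step G (f i) r
    cover r (inj₁ r∈S) with i , fi≡r ← f-onto r∈S = i , inj₁ (sym fi≡r)
    cover r (inj₂ (u , u∈S , u~r)) with i , fi≡u ← f-onto u∈S =
      i , inj₂ (subst (λ x → Adj G x r) (sym fi≡u) u~r)

  win-suc : ∀ {k t} {c : Cops G k} {r} → Win G t c r → Win G (suc t) c r
  win-suc {t = zero}  caught = inj₁ caught
  win-suc {t = suc t} (inj₁ caught) = inj₁ caught
  win-suc {t = suc t} (inj₂ (c' , move , inj₁ caught)) = inj₂ (c' , move , inj₁ caught)
  win-suc {t = suc t} (inj₂ (c' , move , inj₂ win)) =
    inj₂ (c' , move , inj₂ λ r' step → win-suc (win r' step))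

  captWithin-suc : ∀ {k t} → CaptWithin G k t → CaptWithin G k (suc t)
  captWithin-suc (c₀ , win) = c₀ , λ r → win-suc (win r)

  caughtAfterMove : ∀ {k} {c c' : Cops G k} {r} →
                    Move G c c' → _∈c_ G r c' → ∃[ i ] Step G (c i) r
  caughtAfterMove move (i , refl) = i , move i

  captWithin-1⇒copsDominate : ∀ {k} → CaptWithin G k 1 → Σ (Cops G k) CopsDominate
  captWithin-1⇒copsDominate (c₀ , win) = c₀ , λ r → caught r (win r)
    where
    caught : ∀ r → Win G 1 c₀ r → ∃[ i ] Step G (c₀ i) r
    caught r (inj₁ (i , c₀i≡r))                = i , inj₁ (sym c₀i≡r)
    caught r (inj₂ (_ , move , inj₁ r∈c'))     = caughtAfterMove move r∈c'
    caught r (inj₂ (_ , move , inj₂ caughtAt)) = caughtAfterMove move (caughtAt r (inj₁ refl))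

  -- Without capture the damaged set would be ⁅ r ⁆, of size 1 > 0.
  dmgAtMost-0⇒copsDominate : ∀ {k} → DmgAtMost G k 0 → Σ (Cops G k) CopsDominate
  dmgAtMost-0⇒copsDominate (Inv , (c₀ , start) , play) = c₀ , λ r → caught r (start r)
    where
    caught : ∀ r → _∈c_ G r c₀ ⊎ Inv c₀ r ⊥ → ∃[ i ] Step G (c₀ i) r
    caught r (inj₁ (i , c₀i≡r)) = i , inj₁ (sym c₀i≡r)
    caught r (inj₂ inv) with play c₀ r ⊥ inv
    ... | c' , move , inj₁ r∈c' = caughtAfterMove move r∈c'
    ... | _ , _ , inj₂ (damage≤0 , _)
      with ≤-trans (x∈p⇒1≤∣p∣ (x∈p∪q⁺ {p = ⊥} (inj₂ (x∈⁅x⁆ r)))) damage≤0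
    ...   | ()

  ¬captWithin-1-0 : 2 ≤ n → ¬ CaptWithin G 1 0
  ¬captWithin-1-0 (s≤s (s≤s _)) (c₀ , occupied) with occupied zero | occupied (suc zero)
  ... | zero , c₀≡0 | zero , c₀≡1 with trans (sym c₀≡0) c₀≡1
  ...   | ()

  -- The first edge of a walk from a to b leaves a, so it must end at b.
  covered-by-two⇒step : Connected G → ∀ {a b} → (∀ r → r ≡ a ⊎ r ≡ b) → Step G a b
  covered-by-two⇒step conn {a} {b} cover with conn a b
  ... | ε = inj₁ refl
  ... | _◅_ {j = x} a~x _ with cover x
  ...   | inj₁ refl with trans (sym (irrefl x)) a~x
  ...     | ()
  covered-by-two⇒step conn cover | a~x ◅ _ | inj₂ refl = inj₂ a~x

  captWithin-2-0⇒universal : Connected G → CaptWithin G 2 0 → ∃ Universal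
  captWithin-2-0⇒universal conn (c₀ , occupied) = c₀ zero , λ r → reach r (occupied r)
    where
    cover : ∀ r → _∈c_ G r c₀ → r ≡ c₀ zero ⊎ r ≡ c₀ (suc zero)
    cover r (zero , refl)     = inj₁ refl
    cover r (suc zero , refl) = inj₂ refl
    reach : ∀ r → _∈c_ G r c₀ → Step G (c₀ zero) r
    reach r (zero , refl)     = inj₁ refl
    reach r (suc zero , refl) = covered-by-two⇒step conn λ x → cover x (occupied x)

  captWithin-1-1⇒universal : CaptWithin G 1 1 → ∃ Universal
  captWithin-1-1⇒universal capt with c , dom ← captWithin-1⇒copsDominate capt =
    c zero , oneCopDominates⇒universal dom

  isThc-intro : ∀ {k t} → 1 ≤ k → k ≤ n → CaptWithin G k t →
                (∀ {k' t'} → 1 ≤ k' → CaptWithin G k' t' → k + t ≤ k' + t') →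
                IsThc G (k + t)
  isThc-intro {k} {t} 1≤k k≤n capt lower =
    (k , t , 1≤k , k≤n , (capt , λ x capt' → +-cancelˡ-≤ k t x (lower 1≤k capt')) , refl) ,
    λ { _ (_ , _ , 1≤k' , _ , (capt' , _) , refl) → lower 1≤k' capt' }

  isThd-intro : ∀ {k d} → 1 ≤ k → k ≤ n → DmgAtMost G k d →
                (∀ {k' d'} → 1 ≤ k' → DmgAtMost G k' d' → k + d ≤ k' + d') →
                IsThd G (k + d)
  isThd-intro {k} {d} 1≤k k≤n dmg lower =
    (k , d , 1≤k , k≤n , (dmg , λ x dmg' → +-cancelˡ-≤ k d x (lower 1≤k dmg')) , refl) ,
    λ { _ (_ , _ , 1≤k' , _ , (dmg' , _) , refl) → lower 1≤k' dmg' }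

  domNumber⇒copsDominate : ∀ {g} → IsDomNumber G g → Σ (Cops G g) CopsDominate
  domNumber⇒copsDominate ((S , dom , refl) , _) = dominating⇒copsDominate dom

  throttling-γ₁ : 2 ≤ n → IsDomNumber G 1 → IsThc G 2 × IsThd G 1
  throttling-γ₁ 2≤n γ with _ , dom ← domNumber⇒copsDominate γ =
      isThc-intro (s≤s z≤n) 1≤n (copsDominate⇒captWithin-1 dom) captLower
    , isThd-intro (s≤s z≤n) 1≤n (copsDominate⇒dmgAtMost-0 dom)
                  λ {k} {d} 1≤k _ → ≤-trans 1≤k (m≤m+n k d)
    where
    1≤n : 1 ≤ n
    1≤n = ≤-trans (s≤s z≤n) 2≤n
    captLower : ∀ {k t} → 1 ≤ k → CaptWithin G k t → 2 ≤ k + t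
    captLower {1} {0}     _ capt = ⊥-elim (¬captWithin-1-0 2≤n capt)
    captLower {1} {suc t} _ _    = s≤s (s≤s z≤n)
    captLower {suc (suc k)} _ _  = s≤s (s≤s z≤n)

  throttling-γ₂ : 2 ≤ n → Connected G → IsDomNumber G 2 → IsThc G 3 × IsThd G 2
  throttling-γ₂ 2≤n conn γ with _ , dom ← domNumber⇒copsDominate γ =
      isThc-intro (s≤s z≤n) 2≤n (copsDominate⇒captWithin-1 dom) captLower
    , isThd-intro (s≤s z≤n) 2≤n (copsDominate⇒dmgAtMost-0 dom) dmgLower
    where
    ∄univ : ∄ Universal
    ∄univ = domNumber-2⇒∄universal γ
    captLower : ∀ {k t} → 1 ≤ k → CaptWithin G k t → 3 ≤ k + t
    captLower {1} {0} _ capt = ⊥-elim (∄univ (captWithin-1-1⇒universal (captWithin-suc capt)))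
    captLower {1} {1} _ capt = ⊥-elim (∄univ (captWithin-1-1⇒universal capt))
    captLower {1} {suc (suc t)} _ _ = s≤s (s≤s (s≤s z≤n))
    captLower {2} {0} _ capt = ⊥-elim (∄univ (captWithin-2-0⇒universal conn capt))
    captLower {2} {suc t} _ _ = s≤s (s≤s (s≤s z≤n))
    captLower {suc (suc (suc k))} _ _ = s≤s (s≤s (s≤s z≤n))
    dmgLower : ∀ {k d} → 1 ≤ k → DmgAtMost G k d → 2 ≤ k + d
    dmgLower {1} {0} _ dmg with c , dom ← dmgAtMost-0⇒copsDominate dmg =
      ⊥-elim (∄univ (c zero , oneCopDominates⇒universal dom))
    dmgLower {1} {suc d} _ _ = s≤s (s≤s z≤n)
    dmgLower {suc (suc k)} _ _ = s≤s (s≤s z≤n)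

lemma2p18 : ∀ {n} (G : Graph n) → 2 ≤ n → Connected G →
            ∃[ g ] (IsDomNumber G g × g ≤ 2) →
            ∀ m → IsThc G m → IsThd G (m ∸ 1)
lemma2p18 G 2≤n conn (0 , γ , _) m thc with domNumber-positive G (≤-trans (s≤s z≤n) 2≤n) γ
... | ()
lemma2p18 G 2≤n conn (1 , γ , _) m thc with thc₂ , thd₁ ← throttling-γ₁ G 2≤n γ =
  subst (λ x → IsThd G (x ∸ 1)) (isMinimum-unique thc₂ thc) thd₁
lemma2p18 G 2≤n conn (2 , γ , _) m thc with thc₃ , thd₂ ← throttling-γ₂ G 2≤n conn γ =
  subst (λ x → IsThd G (x ∸ 1)) (isMinimum-unique thc₃ thc) thd₂
lemma2p18 G 2≤n conn (suc (suc (suc _)) , _ , s≤s (s≤s ())) m thc
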